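{- For any $2$-connected graph $G$ of order $n$ and any vertex $x$ of $G$, we have $av(G,x)\leq (n-1)/2$, with equality if and only if $G=K_3$.
   Context: A set of vertices is a connected set if it induces a connected subgraph. $G-x$ is the subgraph induced by $V(G)\setminus\{x\}$; $\mathcal C(G-x)$ is the collection of nonempty connected sets of $G-x$; $\mathcal C(G,x)$ is the collection of connected sets of $G$ containing $x$. Definition of $av(G,x)$: fix a shortest distance spanning tree $T$ of $G$ rooted at $x$ (for each vertex $v$, the path in $T$ from $v$ to $x$ has length equal to the distance from $v$ to $x$ in $G$). For each $U\in\mathcal C(G-x)$ choose a vertex $v_U\in U$ closest to $x$, and let $p_U$ be the path in $T$ between $v_U$ and $x$, regarded as its vertex set; $|p_U|$ denotes its length (number of edges). Let $\overline U=U\cup p_U$. For $Q\in\mathcal C(G,x)$ let $W(Q)=\{U\in\mathcal C(G-x):\overline U=Q\}$, ordered by $U\preceq U'$ iff $p_{U'}\subseteq p_U$; when $W(Q)\ne\emptyset$ let $U_Q$ be the minimal element of $W(Q)$. Let $\mathcal M(G-x)=\{U_Q: Q\in\mathcal C(G,x),\ W(Q)\neq\emptyset\}$ and $av(G,x)=\frac{1}{|\mathcal M(G-x)|}\sum_{U\in\mathcal M(G-x)}|p_U|$. -}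

module Defs where

open import Data.Nat using (ℕ; zero; suc; _≤_; _+_)
open import Data.Fin using (Fin)
open import Data.Fin.Subset using (Subset; _∈_; _∉_; _⊆_; _∪_; ⁅_⁆; ∁; ⊤; Nonempty)
open import Data.Integer using (+_)
open import Data.List using (List; []; _∷_; length; map)
open import Data.Nat.ListAction using (sum)
open import Data.List.Relation.Unary.Unique.Propositional using (Unique)
import Data.List.Membership.Propositional as L
open import Data.Rational.Unnormalised using (ℚᵘ; _/_; 0ℚᵘ)
open import Data.Product using (Σ; _×_; ∃)
open import Relation.Binary.PropositionalEquality using (_≡_; _≢_)
open import Relation.Nullary using (¬_)
open import Function.Bundles using (_⇔_)

record Graph (n : ℕ) : Set₁ where
  field
    _~_   : Fin n → Fin n → Set
    sym   : ∀ {u v} → u ~ v → v ~ u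
    irrefl : ∀ {u} → ¬ (u ~ u)
open Graph public

data WalkIn {n : ℕ} (G : Graph n) (U : Subset n) : Fin n → Fin n → Set where
  here : ∀ {u} → u ∈ U → WalkIn G U u u
  step : ∀ {u w v} → u ∈ U → _~_ G u w → WalkIn G U w v → WalkIn G U u v

ConnectedIn : {n : ℕ} → Graph n → Subset n → Set
ConnectedIn G U = ∀ {u v} → u ∈ U → v ∈ U → WalkIn G U u v

ConnectedSet : {n : ℕ} → Graph n → Subset n → Set
ConnectedSet G U = Nonempty U × ConnectedIn G U

TwoConnected : {n : ℕ} → Graph n → Set
TwoConnected {n} G =
  (3 ≤ n) × ConnectedIn G ⊤ × (∀ v → ConnectedIn G (∁ ⁅ v ⁆))

data Walk {n : ℕ} (G : Graph n) : Fin n → Fin n → ℕ → Set where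
  nil  : ∀ {u} → Walk G u u 0
  cons : ∀ {u w v k} → _~_ G u w → Walk G w v k → Walk G u v (suc k)

Dist : {n : ℕ} → Graph n → Fin n → Fin n → ℕ → Set
Dist G u v d = Walk G u v d × (∀ k → Walk G u v k → d ≤ k)

-- A shortest distance spanning tree of G rooted at x, given by its parent
-- function: the tree path from v to x is v, parent v, parent (parent v), ...,
-- and its length (depth v) equals the distance from v to x in G.
record SDTree {n : ℕ} (G : Graph n) (x : Fin n) : Set where
  field
    parent       : Fin n → Fin n
    depth        : Fin n → ℕ
    depth-dist   : ∀ v → Dist G v x (depth v)
    parent-adj   : ∀ v → v ≢ x → _~_ G v (parent v)
    parent-depth : ∀ v → v ≢ x → suc (depth (parent v)) ≡ depth v
open SDTree public

module _ {n : ℕ} {G : Graph n} {x : Fin n} (T : SDTree G x) where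

  climb : Fin n → ℕ → Subset n
  climb v zero    = ⁅ v ⁆
  climb v (suc k) = ⁅ v ⁆ ∪ climb (parent T v) k

  treePath : Fin n → Subset n
  treePath v = climb v (depth T v)

InCminus : {n : ℕ} → Graph n → Fin n → Subset n → Set
InCminus G x U = x ∉ U × ConnectedSet G U

InCat : {n : ℕ} → Graph n → Fin n → Subset n → Set
InCat G x Q = x ∈ Q × ConnectedSet G Q

record Choice {n : ℕ} {G : Graph n} {x : Fin n} (T : SDTree G x) : Set where
  field
    pick     : Subset n → Fin n
    pick-in  : ∀ U → InCminus G x U → pick U ∈ U
    pick-min : ∀ U → InCminus G x U → ∀ w → w ∈ U → depth T (pick U) ≤ depth T w
open Choice public

module _ {n : ℕ} {G : Graph n} {x : Fin n} {T : SDTree G x} (c : Choice T) where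

  pU : Subset n → Subset n
  pU U = treePath T (pick c U)

  lenP : Subset n → ℕ
  lenP U = depth T (pick c U)

  bar : Subset n → Subset n
  bar U = U ∪ pU U

  InW : Subset n → Subset n → Set
  InW Q U = InCminus G x U × bar U ≡ Q

  _⪯_ : Subset n → Subset n → Set
  U ⪯ U' = pU U' ⊆ pU U

  -- U ∈ M(G - x): U = U_Q for some Q ∈ C(G,x) with W(Q) ≠ ∅,
  -- i.e. U ∈ W(Q) and U is the minimal element of W(Q).
  InM : Subset n → Set
  InM U = ∃ λ Q → InCat G x Q × InW Q U × (∀ U' → InW Q U' → U ⪯ U')

  EnumM : List (Subset n) → Set
  EnumM Ms = Unique Ms × (∀ U → (U L.∈ Ms) ⇔ InM U)

-- average of a list of naturals as a rational (0 for the empty list)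
avg : List ℕ → ℚᵘ
avg []       = 0ℚᵘ
avg (a ∷ as) = (+ sum (a ∷ as)) / length (a ∷ as)

av : {n : ℕ} {G : Graph n} {x : Fin n} {T : SDTree G x} →
     Choice T → List (Subset n) → ℚᵘ
av c Ms = avg (map (lenP c) Ms)

IsK3 : {n : ℕ} → Graph n → Set
IsK3 {n} G = (n ≡ 3) × (∀ u v → u ≢ v → _~_ G u v)

-- Write d for the depth in T. If d(v) = j, each level 1, ..., j - 1 holds at least
-- two vertices: one on a walk from v to x, and one on a walk from v to x avoiding
-- the first. Together with x and v this gives 2 d(v) ≤ n, with equality only when v
-- is the unique deepest vertex. Hence 2 |p_U| ≤ n - 1 for all U ∈ M(G - x) but at
-- most one. The singletons of two neighbours w ≠ w' of x lie in M(G - x) with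
-- |p| = 1, each n - 3 below that bound, so
--   2 Σ |p_U| + 2 (n - 3) ≤ (n - 1) |M(G - x)| + 1.
-- This forces av(G,x) ≤ (n - 1)/2, with equality only if n = 3, and a 2-connected
-- graph on three vertices is K₃.
module Submission where

open import Defs hiding (sym; _~_; irrefl; parent; depth; depth-dist; parent-adj; parent-depth)
open import Data.Nat using (ℕ; _∸_; zero; suc; s≤s)
open import Data.Fin using (Fin)
open import Data.Fin.Subset using (Subset)
open import Data.List using (List)
open import Data.Product using (_×_; _,_; proj₁; proj₂)
open import Function.Bundles using (_⇔_; mk⇔; Equivalence)

-- The order on ℕ is opened only inside this block, so that after it _≤_ denotes
-- the order on ℚᵘ.
module _ where
  open import Data.Nat using (_+_; _*_; _≤_; _<_; _≟_; z≤n)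
  open import Data.Nat.Properties
  open import Data.Nat.ListAction using (sum)
  open import Algebra.Properties.CommutativeSemigroup +-commutativeSemigroup using (interchange)
  open import Data.Fin using (zero; suc)
  open import Data.Fin.Properties using (all?) renaming (_≟_ to _≟ᶠ_)
  open import Data.Fin.Subset using (_∈_; _∉_; _∪_; ⁅_⁆; ∁; ⊤; ⊥; ∣_∣)
  open import Data.Fin.Subset.Properties
  import Data.Integer as ℤ
  open import Data.Integer.Properties using (pos-*; +-injective)
  open import Data.List using ([]; _∷_; length; map)
  open import Data.List.Properties using (length-map)
  open import Data.List.Membership.Propositional using () renaming (_∈_ to _∈ₗ_)
  open import Data.List.Relation.Unary.Any using (here; there)
  open import Data.List.Relation.Unary.All as All using ()
  open import Data.List.Relation.Unary.AllPairs using (_∷_)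
  open import Data.List.Relation.Unary.Unique.Propositional using (Unique)
  import Data.Rational.Unnormalised as ℚ
  open import Data.Product using (∃; ∃₂)
  open import Data.Sum using (_⊎_; inj₁; inj₂)
  open import Data.Empty using (⊥-elim)
  open import Function using (_∘_)
  open import Relation.Nullary using (yes; no; contradiction)
  open import Relation.Nullary.Decidable using (from-yes; ¬?; _→-dec_; decidable-stable)
  open import Relation.Binary.PropositionalEquality

  avoid-two : ∀ {k} (a b : Fin (3 + k)) → ∃ λ y → y ≢ a × y ≢ b
  avoid-two (suc _)       (suc _)       = zero , (λ ()) , (λ ())
  avoid-two zero          zero          = suc zero , (λ ()) , (λ ())
  avoid-two zero          (suc zero)    = suc (suc zero) , (λ ()) , (λ ())
  avoid-two zero          (suc (suc _)) = suc zero , (λ ()) , (λ ())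
  avoid-two (suc zero)    zero          = suc (suc zero) , (λ ()) , (λ ())
  avoid-two (suc (suc _)) zero          = suc zero , (λ ()) , (λ ())

  fin3-remaining : (u v z w : Fin 3) → u ≢ v → z ≢ u → z ≢ v → w ≢ v → w ≢ z → w ≡ u
  fin3-remaining = from-yes (all? {n = 3} λ u → all? {n = 3} λ v → all? {n = 3} λ z → all? {n = 3} λ w →
    ¬? (u ≟ᶠ v) →-dec ¬? (z ≟ᶠ u) →-dec ¬? (z ≟ᶠ v) →-dec ¬? (w ≟ᶠ v) →-dec ¬? (w ≟ᶠ z) →-dec w ≟ᶠ u)

  x∉p⇒∣p∣<∣p∪⁅x⁆∣ : ∀ {n} {x : Fin n} {p : Subset n} → x ∉ p → ∣ p ∣ < ∣ p ∪ ⁅ x ⁆ ∣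
  x∉p⇒∣p∣<∣p∪⁅x⁆∣ {x = x} {p} x∉p = p⊂q⇒∣p∣<∣q∣ (p⊆p∪q ⁅ x ⁆ , x , q⊆p∪q p ⁅ x ⁆ (x∈⁅x⁆ x) , x∉p)

  x∈⁅y⁆∪⁅z⁆⁻ : ∀ {n} {x y z : Fin n} → x ∈ ⁅ y ⁆ ∪ ⁅ z ⁆ → x ≡ y ⊎ x ≡ z
  x∈⁅y⁆∪⁅z⁆⁻ {y = y} {z} x∈ with x∈p∪q⁻ ⁅ y ⁆ ⁅ z ⁆ x∈
  ... | inj₁ x∈y = inj₁ (x∈⁅y⁆⇒x≡y y x∈y)
  ... | inj₂ x∈z = inj₂ (x∈⁅y⁆⇒x≡y z x∈z)

  x≢y⇒x∈∁⁅y⁆ : ∀ {n} {x y : Fin n} → x ≢ y → x ∈ ∁ ⁅ y ⁆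
  x≢y⇒x∈∁⁅y⁆ = x∉p⇒x∈∁p ∘ x≢y⇒x∉⁅y⁆

  x∈∁⁅y⁆⇒x≢y : ∀ {n} {x y : Fin n} → x ∈ ∁ ⁅ y ⁆ → x ≢ y
  x∈∁⁅y⁆⇒x≢y x∈ = x∉⁅y⁆⇒x≢y (x∈∁p⇒x∉p x∈)

  module _ {A : Set} where

    sum-map-+ : ∀ (f g : A → ℕ) xs → sum (map (λ a → f a + g a) xs) ≡ sum (map f xs) + sum (map g xs)
    sum-map-+ f g []       = refl
    sum-map-+ f g (a ∷ xs) = begin
      f a + g a + sum (map (λ a → f a + g a) xs)     ≡⟨ cong (f a + g a +_) (sum-map-+ f g xs) ⟩
      f a + g a + (sum (map f xs) + sum (map g xs))  ≡⟨ interchange (f a) (g a) _ _ ⟩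
      f a + sum (map f xs) + (g a + sum (map g xs))  ∎
      where open ≡-Reasoning

    sum-map-*ˡ : ∀ k (f : A → ℕ) xs → sum (map (λ a → k * f a) xs) ≡ k * sum (map f xs)
    sum-map-*ˡ k f []       = sym (*-zeroʳ k)
    sum-map-*ˡ k f (a ∷ xs) = trans (cong (k * f a +_) (sum-map-*ˡ k f xs)) (sym (*-distribˡ-+ k (f a) _))

    ∈⇒≤-sum-map : ∀ (f : A → ℕ) {a xs} → a ∈ₗ xs → f a ≤ sum (map f xs)
    ∈⇒≤-sum-map f {xs = _ ∷ xs} (here refl) = m≤m+n _ (sum (map f xs))
    ∈⇒≤-sum-map f {xs = b ∷ _}  (there a∈)  = ≤-trans (∈⇒≤-sum-map f a∈) (m≤n+m _ (f b))

    two-∈⇒≤-sum-map : ∀ (f : A → ℕ) {a b xs} → a ≢ b → a ∈ₗ xs → b ∈ₗ xs → f a + f b ≤ sum (map f xs)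
    two-∈⇒≤-sum-map f a≢b (here refl) (here refl) = contradiction refl a≢b
    two-∈⇒≤-sum-map f a≢b (here refl) (there b∈)  = +-monoʳ-≤ _ (∈⇒≤-sum-map f b∈)
    two-∈⇒≤-sum-map f {a} {b} a≢b (there a∈) (here refl) =
      ≤-trans (≤-reflexive (+-comm (f a) (f b))) (+-monoʳ-≤ (f b) (∈⇒≤-sum-map f a∈))
    two-∈⇒≤-sum-map f {xs = c ∷ _} a≢b (there a∈) (there b∈) =
      ≤-trans (two-∈⇒≤-sum-map f a≢b a∈ b∈) (m≤n+m _ (f c))

    sum-map-≤ : ∀ (f : A → ℕ) m xs → (∀ {a} → a ∈ₗ xs → f a ≤ m) → sum (map f xs) ≤ m * length xs
    sum-map-≤ f m []       _     = z≤n
    sum-map-≤ f m (a ∷ xs) bound = begin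
      f a + sum (map f xs)  ≤⟨ +-mono-≤ (bound (here refl)) (sum-map-≤ f m xs (bound ∘ there)) ⟩
      m + m * length xs     ≡⟨ *-suc m (length xs) ⟨
      m * suc (length xs)   ∎
      where open ≤-Reasoning

    sum-map-≤-but-one : ∀ (f : A → ℕ) m xs → Unique xs → (∀ {a} → a ∈ₗ xs → f a ≤ suc m) →
      (∀ {a b} → a ∈ₗ xs → b ∈ₗ xs → f a ≡ suc m → f b ≡ suc m → a ≡ b) →
      sum (map f xs) ≤ m * length xs + 1
    sum-map-≤-but-one f m []       _                 _     _          = z≤n
    sum-map-≤-but-one f m (a ∷ xs) (a∉xs ∷ unique) bound at-most-one with f a ≟ suc m
    ... | yes fa≡ = begin
      f a + sum (map f xs)     ≤⟨ +-mono-≤ (≤-reflexive fa≡) (sum-map-≤ f m xs below) ⟩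
      suc m + m * length xs    ≡⟨ cong suc (*-suc m (length xs)) ⟨
      suc (m * length (a ∷ xs))  ≡⟨ +-comm 1 _ ⟩
      m * length (a ∷ xs) + 1  ∎
      where
        open ≤-Reasoning
        below : ∀ {b} → b ∈ₗ xs → f b ≤ m
        below b∈ = ≤-pred (≤∧≢⇒< (bound (there b∈))
          (λ fb≡ → All.lookup a∉xs b∈ (at-most-one (here refl) (there b∈) fa≡ fb≡)))
    ... | no fa≢ = begin
      f a + sum (map f xs)         ≤⟨ +-mono-≤ (≤-pred (≤∧≢⇒< (bound (here refl)) fa≢))
                                       (sum-map-≤-but-one f m xs unique (bound ∘ there)
                                         (λ a∈ b∈ → at-most-one (there a∈) (there b∈))) ⟩
      m + (m * length xs + 1)      ≡⟨ +-assoc m _ 1 ⟨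
      m + m * length xs + 1        ≡⟨ cong (_+ 1) (*-suc m (length xs)) ⟨
      m * length (a ∷ xs) + 1      ∎
      where open ≤-Reasoning

    sum-map-≡-length : ∀ (f : A → ℕ) xs → (∀ {a} → a ∈ₗ xs → f a ≡ 1) → sum (map f xs) ≡ length xs
    sum-map-≡-length f []       _   = refl
    sum-map-≡-length f (a ∷ xs) one = cong₂ _+_ (one (here refl)) (sum-map-≡-length f xs (one ∘ there))

    -- With h = 2 f and m = 2 + k, each h a + (m ∸ h a) is the maximum of m and h a,
    -- so at most one of them exceeds m; the slack m ∸ h = k at the two elements with
    -- f = 1 accounts for the 2 k.
    doubled-sum-bound : ∀ k (f : A → ℕ) xs → Unique xs →
      (∀ {a} → a ∈ₗ xs → 2 * f a ≤ 3 + k) →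
      (∀ {a b} → a ∈ₗ xs → b ∈ₗ xs → 2 * f a ≡ 3 + k → 2 * f b ≡ 3 + k → a ≡ b) →
      ∀ {a b} → a ≢ b → a ∈ₗ xs → b ∈ₗ xs → f a ≡ 1 → f b ≡ 1 →
      2 * sum (map f xs) + 2 * k ≤ (2 + k) * length xs + 1
    doubled-sum-bound k f xs unique bound at-most-one {a} {b} a≢b a∈ b∈ fa≡1 fb≡1 = begin
      2 * sum (map f xs) + 2 * k                   ≤⟨ +-mono-≤ (≤-reflexive (sym (sum-map-*ˡ 2 f xs))) slack-bound ⟩
      sum (map h xs) + sum (map slack xs)          ≡⟨ sum-map-+ h slack xs ⟨
      sum (map (λ a → h a + slack a) xs)           ≤⟨ sum-map-≤-but-one _ m xs unique capped-≤ capped-unique ⟩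
      m * length xs + 1                            ∎
      where
        open ≤-Reasoning
        m = 2 + k
        h slack : A → ℕ
        h a = 2 * f a
        slack a = m ∸ h a

        capped : ∀ {a} → a ∈ₗ xs → h a + slack a ≡ m ⊎ h a ≡ suc m
        capped a∈ with m≤n⇒m<n∨m≡n (bound a∈)
        ... | inj₁ ha<1+m = inj₁ (m+[n∸m]≡n (≤-pred ha<1+m))
        ... | inj₂ ha≡1+m = inj₂ ha≡1+m

        capped-≤ : ∀ {a} → a ∈ₗ xs → h a + slack a ≤ suc m
        capped-≤ a∈ with capped a∈
        ... | inj₁ ≡m    = ≤-trans (≤-reflexive ≡m) (n≤1+n m)
        ... | inj₂ ha≡1+m rewrite ha≡1+m | m≤n⇒m∸n≡0 (n≤1+n m) = ≤-reflexive (+-identityʳ (suc m))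

        capped-unique : ∀ {a b} → a ∈ₗ xs → b ∈ₗ xs → h a + slack a ≡ suc m → h b + slack b ≡ suc m → a ≡ b
        capped-unique a∈ b∈ ea eb = at-most-one a∈ b∈ (attained a∈ ea) (attained b∈ eb)
          where
            attained : ∀ {a} → a ∈ₗ xs → h a + slack a ≡ suc m → h a ≡ suc m
            attained a∈ e with capped a∈
            ... | inj₁ ≡m    = contradiction (trans (sym ≡m) e) (λ ())
            ... | inj₂ ha≡1+m = ha≡1+m

        slack-bound : 2 * k ≤ sum (map slack xs)
        slack-bound = begin
          2 * k              ≡⟨ cong (k +_) (+-identityʳ k) ⟩
          k + k              ≡⟨ cong₂ _+_ (cong (λ t → m ∸ 2 * t) fa≡1) (cong (λ t → m ∸ 2 * t) fb≡1) ⟨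
          slack a + slack b  ≤⟨ two-∈⇒≤-sum-map slack a≢b a∈ b∈ ⟩
          sum (map slack xs) ∎

  -- For k = 0 the + 1 is absorbed by parity, for k > 0 by the slack 2 k.
  halving : ∀ k s l → 2 * s + 2 * k ≤ (2 + k) * l + 1 →
    2 * s ≤ (2 + k) * l × (2 * s ≡ (2 + k) * l → k ≡ 0)
  halving zero s l le = *-monoʳ-≤ 2 s≤l , λ _ → refl
    where
      s≤l : s ≤ l
      s≤l = ≮⇒≥ λ l<s → 1+n≰n (begin
        suc (2 * l) + 1    ≡⟨ +-comm _ 1 ⟩
        2 + 2 * l          ≡⟨ *-suc 2 l ⟨
        2 * suc l          ≤⟨ *-monoʳ-≤ 2 l<s ⟩
        2 * s              ≤⟨ m≤m+n (2 * s) 0 ⟩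
        2 * s + 0          ≤⟨ le ⟩
        2 * l + 1          ∎)
        where open ≤-Reasoning
  halving (suc k) s l le = <⇒≤ 2s<ml , ⊥-elim ∘ <⇒≢ 2s<ml
    where
      2s<ml : 2 * s < (3 + k) * l
      2s<ml = ≤-pred (begin
        suc (suc (2 * s))  ≡⟨ +-comm 2 (2 * s) ⟩
        2 * s + 2          ≤⟨ +-monoʳ-≤ (2 * s) (*-monoʳ-≤ 2 (s≤s z≤n)) ⟩
        2 * s + 2 * suc k  ≤⟨ le ⟩
        (3 + k) * l + 1    ≡⟨ +-comm _ 1 ⟩
        suc ((3 + k) * l)  ∎)
        where open ≤-Reasoning

  module _ {A : Set} (f : A → ℕ) (m : ℕ) where
    private
      numerator : ∀ xs → ℤ.+ sum (map f xs) ℤ.* ℤ.+ 2 ≡ ℤ.+ (2 * sum (map f xs))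
      numerator xs = trans (sym (pos-* (sum (map f xs)) 2)) (cong ℤ.+_ (*-comm (sum (map f xs)) 2))

      denominator : ∀ xs → ℤ.+ m ℤ.* ℤ.+ length (map f xs) ≡ ℤ.+ (m * length xs)
      denominator xs = trans (sym (pos-* m _)) (cong (λ l → ℤ.+ (m * l)) (length-map f xs))

    avg-map-≤-half : ∀ xs → 2 * sum (map f xs) ≤ m * length xs → avg (map f xs) ℚ.≤ ℤ.+ m ℚ./ 2
    avg-map-≤-half []          _  = ℚ.*≤* (subst (ℤ._≤_ (ℤ.+ 0)) (pos-* m 1) (ℤ.+≤+ z≤n))
    avg-map-≤-half xs@(_ ∷ _) le = ℚ.*≤* (subst₂ ℤ._≤_ (sym (numerator xs)) (sym (denominator xs)) (ℤ.+≤+ le))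

    avg-map-≃-half : ∀ {a} xs → a ∈ₗ xs →
      (avg (map f xs) ℚ.≃ ℤ.+ m ℚ./ 2) ⇔ (2 * sum (map f xs) ≡ m * length xs)
    avg-map-≃-half xs@(_ ∷ _) _ = mk⇔
      (λ { (ℚ.*≡* e) → +-injective (trans (sym (numerator xs)) (trans e (denominator xs))) })
      (λ e → ℚ.*≡* (trans (numerator xs) (trans (cong ℤ.+_ e) (sym (denominator xs)))))

  walk-length-0 : ∀ {n} {G : Graph n} {u v} → Walk G u v 0 → u ≡ v
  walk-length-0 nil = refl

  module _ {n : ℕ} {G : Graph n} where
    open Graph G using (_~_; irrefl) renaming (sym to ~-sym)

    adjacent⇒≢ : ∀ {u v} → u ~ v → u ≢ v
    adjacent⇒≢ {u} u~v u≡v = irrefl (subst (u ~_) (sym u≡v) u~v)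

    last-edge : ∀ {U a b} → WalkIn G U a b → a ≢ b → ∃ λ w → w ∈ U × w ~ b
    last-edge (here _) a≢b = contradiction refl a≢b
    last-edge {a = a} {b} (step {w = w} a∈ a~w rest) _ with w ≟ᶠ b
    ... | yes refl = a , a∈ , a~w
    ... | no  w≢b  = last-edge rest w≢b

    singleton-connected : ∀ {w} → ConnectedSet G ⁅ w ⁆
    singleton-connected {w} = (w , x∈⁅x⁆ w) , λ u∈ v∈ →
      subst₂ (WalkIn G ⁅ w ⁆) (sym (x∈⁅y⁆⇒x≡y w u∈)) (sym (x∈⁅y⁆⇒x≡y w v∈)) (here (x∈⁅x⁆ w))

    edge-connected : ∀ {u v} → u ~ v → ConnectedSet G (⁅ u ⁆ ∪ ⁅ v ⁆)
    edge-connected {u} {v} u~v = (u , p⊆p∪q ⁅ v ⁆ (x∈⁅x⁆ u)) , walk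
      where
        walk : ConnectedIn G (⁅ u ⁆ ∪ ⁅ v ⁆)
        walk a∈ b∈ with x∈⁅y⁆∪⁅z⁆⁻ a∈ | x∈⁅y⁆∪⁅z⁆⁻ b∈
        ... | inj₁ refl | inj₁ refl = here a∈
        ... | inj₁ refl | inj₂ refl = step a∈ u~v (here b∈)
        ... | inj₂ refl | inj₁ refl = step a∈ (~-sym u~v) (here b∈)
        ... | inj₂ refl | inj₂ refl = here a∈

    module _ {x : Fin n} (T : SDTree G x) where
      open SDTree T

      depth-root : depth x ≡ 0
      depth-root = n≤0⇒n≡0 (proj₂ (depth-dist x) 0 nil)

      depth-root-≤ : ∀ i → depth x ≤ i
      depth-root-≤ i = subst (_≤ i) (sym depth-root) z≤n

      depth≡0⇒root : ∀ {v} → depth v ≡ 0 → v ≡ x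
      depth≡0⇒root {v} e = walk-length-0 (subst (Walk G v x) e (proj₁ (depth-dist v)))

      depth-edge : ∀ {u w} → u ~ w → depth u ≤ suc (depth w)
      depth-edge {u} {w} u~w = proj₂ (depth-dist u) _ (cons u~w (proj₁ (depth-dist w)))

      depth-neighbour : ∀ {w} → w ~ x → depth w ≡ 1
      depth-neighbour {w} w~x = ≤-antisym (proj₂ (depth-dist w) 1 (cons w~x nil))
        (n≢0⇒n>0 (λ e → adjacent⇒≢ w~x (depth≡0⇒root e)))

      parent-neighbour : ∀ {w} → w ~ x → parent w ≡ x
      parent-neighbour {w} w~x = depth≡0⇒root
        (suc-injective (trans (parent-depth w (adjacent⇒≢ w~x)) (depth-neighbour w~x)))

      walk-meets-depth : ∀ {U a b} i → WalkIn G U a b → depth b ≤ i → i ≤ depth a →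
        ∃ λ w → w ∈ U × depth w ≡ i
      walk-meets-depth i (here a∈) b≤i i≤a = _ , a∈ , ≤-antisym b≤i i≤a
      walk-meets-depth {a = a} i (step a∈ a~w rest) b≤i i≤a with depth a ≟ i
      ... | yes da≡i = a , a∈ , da≡i
      ... | no  da≢i = walk-meets-depth i rest b≤i
                         (≤-pred (≤-trans (≤∧≢⇒< i≤a (da≢i ∘ sym)) (depth-edge a~w)))

      deeper⇒∉ : ∀ {P : Subset n} {i a} → (∀ {w} → w ∈ P → depth w ≤ i) → i < depth a → a ∉ P
      deeper⇒∉ P≤i i<da a∈P = <⇒≱ i<da (P≤i a∈P)

      module _ (tc : TwoConnected G) where
        private
          connected : ConnectedIn G ⊤
          connected = proj₁ (proj₂ tc)

          connected-without : ∀ v → ConnectedIn G (∁ ⁅ v ⁆)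
          connected-without = proj₂ (proj₂ tc)

        two-at-depth : ∀ {v} i → suc i < depth v → ∃₂ λ a b → a ≢ b × depth a ≡ suc i × depth b ≡ suc i
        two-at-depth {v} i lt
          with walk-meets-depth (suc i) (connected {v} {x} ∈⊤ ∈⊤) (depth-root-≤ _) (<⇒≤ lt)
        ... | a , _ , da
          with walk-meets-depth (suc i) (connected-without a (x≢y⇒x∈∁⁅y⁆ v≢a) (x≢y⇒x∈∁⁅y⁆ x≢a))
                 (depth-root-≤ _) (<⇒≤ lt)
          where
            v≢a : v ≢ a
            v≢a v≡a = <⇒≢ lt (sym (trans (cong depth v≡a) da))
            x≢a : x ≢ a
            x≢a x≡a = 0≢1+n (trans (sym depth-root) (trans (cong depth x≡a) da))
        ... | b , b∈ , db = a , b , (λ a≡b → x∈∁⁅y⁆⇒x≢y b∈ (sym a≡b)) , da , db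

        ball-size : ∀ {v} i → i < depth v → ∃ λ P → suc (2 * i) ≤ ∣ P ∣ × (∀ {w} → w ∈ P → depth w ≤ i)
        ball-size zero _ = ⁅ x ⁆ , ≤-reflexive (sym (∣⁅x⁆∣≡1 x)) ,
          λ w∈ → ≤-reflexive (trans (cong depth (x∈⁅y⁆⇒x≡y x w∈)) depth-root)
        ball-size (suc i) lt with ball-size i (<-trans (n<1+n i) lt) | two-at-depth i lt
        ... | P , |P| , P≤i | a , b , a≢b , da , db = (P ∪ ⁅ a ⁆) ∪ ⁅ b ⁆ , size , shallow
          where
            b∉ : b ∉ P ∪ ⁅ a ⁆
            b∉ b∈ with x∈p∪q⁻ P ⁅ a ⁆ b∈
            ... | inj₁ b∈P = deeper⇒∉ P≤i (≤-reflexive (sym db)) b∈P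
            ... | inj₂ b∈a = a≢b (sym (x∈⁅y⁆⇒x≡y a b∈a))

            size : suc (2 * suc i) ≤ ∣ (P ∪ ⁅ a ⁆) ∪ ⁅ b ⁆ ∣
            size = begin
              suc (2 * suc i)           ≡⟨ cong suc (*-suc 2 i) ⟩
              suc (suc (suc (2 * i)))   ≤⟨ s≤s (s≤s |P|) ⟩
              suc (suc ∣ P ∣)           ≤⟨ s≤s (x∉p⇒∣p∣<∣p∪⁅x⁆∣ (deeper⇒∉ P≤i (≤-reflexive (sym da)))) ⟩
              suc ∣ P ∪ ⁅ a ⁆ ∣         ≤⟨ x∉p⇒∣p∣<∣p∪⁅x⁆∣ b∉ ⟩
              ∣ (P ∪ ⁅ a ⁆) ∪ ⁅ b ⁆ ∣   ∎
              where open ≤-Reasoning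

            shallow : ∀ {w} → w ∈ (P ∪ ⁅ a ⁆) ∪ ⁅ b ⁆ → depth w ≤ suc i
            shallow w∈ with x∈p∪q⁻ (P ∪ ⁅ a ⁆) ⁅ b ⁆ w∈
            ... | inj₂ w∈b = ≤-reflexive (trans (cong depth (x∈⁅y⁆⇒x≡y b w∈b)) db)
            ... | inj₁ w∈Pa with x∈p∪q⁻ P ⁅ a ⁆ w∈Pa
            ...   | inj₁ w∈P = m≤n⇒m≤1+n (P≤i w∈P)
            ...   | inj₂ w∈a = ≤-reflexive (trans (cong depth (x∈⁅y⁆⇒x≡y a w∈a)) da)

        lower-set-size : ∀ v → ∃ λ P → 2 * depth v ≤ ∣ P ∣ × (∀ {w} → w ∈ P → depth w < depth v ⊎ w ≡ v)
        lower-set-size v with depth v in dv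
        ... | zero  = ⊥ , z≤n , λ w∈ → contradiction w∈ ∉⊥
        ... | suc j with ball-size j (≤-reflexive (sym dv))
        ...   | P , |P| , P≤j = P ∪ ⁅ v ⁆ , size , members
          where
            size : 2 * suc j ≤ ∣ P ∪ ⁅ v ⁆ ∣
            size = begin
              2 * suc j         ≡⟨ *-suc 2 j ⟩
              suc (suc (2 * j)) ≤⟨ s≤s |P| ⟩
              suc ∣ P ∣         ≤⟨ x∉p⇒∣p∣<∣p∪⁅x⁆∣ (deeper⇒∉ P≤j (≤-reflexive (sym dv))) ⟩
              ∣ P ∪ ⁅ v ⁆ ∣     ∎
              where open ≤-Reasoning

            members : ∀ {w} → w ∈ P ∪ ⁅ v ⁆ → depth w < suc j ⊎ w ≡ v
            members w∈ with x∈p∪q⁻ P ⁅ v ⁆ w∈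
            ... | inj₁ w∈P = inj₁ (s≤s (P≤j w∈P))
            ... | inj₂ w∈v = inj₂ (x∈⁅y⁆⇒x≡y v w∈v)

        depth-bound : ∀ v → 2 * depth v ≤ n
        depth-bound v with lower-set-size v
        ... | P , size , _ = ≤-trans size (∣p∣≤n P)

        depth-bound-strict : ∀ {u v} → u ≢ v → depth v ≤ depth u → suc (2 * depth v) ≤ n
        depth-bound-strict {u} {v} u≢v dv≤du with lower-set-size v
        ... | P , size , members = ≤-trans (≤-trans (s≤s size) (x∉p⇒∣p∣<∣p∪⁅x⁆∣ u∉P)) (∣p∣≤n (P ∪ ⁅ u ⁆))
          where
            u∉P : u ∉ P
            u∉P u∈P with members u∈P
            ... | inj₁ du<dv = <⇒≱ du<dv dv≤du
            ... | inj₂ u≡v   = u≢v u≡v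

        deepest-unique : ∀ {u v} → 2 * depth v ≡ n → depth v ≤ depth u → u ≡ v
        deepest-unique {u} {v} 2dv≡n dv≤du = decidable-stable (u ≟ᶠ v) λ u≢v →
          1+n≰n (subst (suc (2 * depth v) ≤_) (sym 2dv≡n) (depth-bound-strict u≢v dv≤du))

        module _ (c : Choice T) where

          lenP-bound : ∀ U → 2 * lenP c U ≤ n
          lenP-bound U = depth-bound (pick c U)

          lenP-extremal : ∀ {U} → InCminus G x U → 2 * lenP c U ≡ n → U ≡ ⁅ pick c U ⁆
          lenP-extremal {U} U∈C 2ℓ≡n = ⊆-antisym
            (λ {w} w∈ → subst (_∈ ⁅ pick c U ⁆) (sym (deepest-unique 2ℓ≡n (pick-min c U U∈C w w∈))) (x∈⁅x⁆ _))
            (λ w∈ → subst (_∈ U) (sym (x∈⁅y⁆⇒x≡y _ w∈)) (pick-in c U U∈C))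

          lenP-extremal-unique : ∀ {U U′} → InCminus G x U → InCminus G x U′ →
            2 * lenP c U ≡ n → 2 * lenP c U′ ≡ n → U ≡ U′
          lenP-extremal-unique {U} {U′} U∈C U′∈C 2ℓ≡n 2ℓ′≡n = begin
            U                ≡⟨ lenP-extremal U∈C 2ℓ≡n ⟩
            ⁅ pick c U ⁆     ≡⟨ cong ⁅_⁆ (deepest-unique 2ℓ′≡n (≤-reflexive ℓ′≡ℓ)) ⟩
            ⁅ pick c U′ ⁆    ≡⟨ lenP-extremal U′∈C 2ℓ′≡n ⟨
            U′               ∎
            where
              open ≡-Reasoning
              ℓ′≡ℓ : lenP c U′ ≡ lenP c U
              ℓ′≡ℓ = *-cancelˡ-≡ _ _ 2 (trans 2ℓ′≡n (sym 2ℓ≡n))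

      module _ (c : Choice T) where

        pick≢root : ∀ {U} → InCminus G x U → pick c U ≢ x
        pick≢root {U} (x∉U , U-connected) pick≡x = x∉U (subst (_∈ U) pick≡x (pick-in c U (x∉U , U-connected)))

        singleton-∈C : ∀ {w} → w ≢ x → InCminus G x ⁅ w ⁆
        singleton-∈C w≢x = x≢y⇒x∉⁅y⁆ (w≢x ∘ sym) , singleton-connected

        pick-singleton : ∀ {w} → w ≢ x → pick c ⁅ w ⁆ ≡ w
        pick-singleton w≢x = x∈⁅y⁆⇒x≡y _ (pick-in c _ (singleton-∈C w≢x))

        lenP-neighbour : ∀ {w} → w ~ x → lenP c ⁅ w ⁆ ≡ 1
        lenP-neighbour w~x = trans (cong depth (pick-singleton (adjacent⇒≢ w~x))) (depth-neighbour w~x)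

        bar-neighbour : ∀ {w} → w ~ x → bar c ⁅ w ⁆ ≡ ⁅ w ⁆ ∪ ⁅ x ⁆
        bar-neighbour {w} w~x = begin
          ⁅ w ⁆ ∪ treePath T (pick c ⁅ w ⁆)  ≡⟨ cong (λ v → ⁅ w ⁆ ∪ treePath T v) (pick-singleton (adjacent⇒≢ w~x)) ⟩
          ⁅ w ⁆ ∪ climb T w (depth w)        ≡⟨ cong (λ i → ⁅ w ⁆ ∪ climb T w i) (depth-neighbour w~x) ⟩
          ⁅ w ⁆ ∪ (⁅ w ⁆ ∪ ⁅ parent w ⁆)     ≡⟨ cong (λ p → ⁅ w ⁆ ∪ (⁅ w ⁆ ∪ ⁅ p ⁆)) (parent-neighbour w~x) ⟩
          ⁅ w ⁆ ∪ (⁅ w ⁆ ∪ ⁅ x ⁆)            ≡⟨ ∪-assoc ⁅ w ⁆ ⁅ w ⁆ ⁅ x ⁆ ⟨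
          (⁅ w ⁆ ∪ ⁅ w ⁆) ∪ ⁅ x ⁆            ≡⟨ cong (_∪ ⁅ x ⁆) (∪-idem ⁅ w ⁆) ⟩
          ⁅ w ⁆ ∪ ⁅ x ⁆                      ∎
          where open ≡-Reasoning

        -- Ū = {w, x} forces v_U = w, so every U ∈ W({w, x}) has p_U = p_{w}.
        neighbour-∈M : ∀ {w} → w ~ x → InM c ⁅ w ⁆
        neighbour-∈M {w} w~x = bar c ⁅ w ⁆ , bar∈C , (singleton-∈C w≢x , refl) , minimal
          where
            w≢x : w ≢ x
            w≢x = adjacent⇒≢ w~x

            bar∈C : InCat G x (bar c ⁅ w ⁆)
            bar∈C = subst (InCat G x) (sym (bar-neighbour w~x)) (q⊆p∪q ⁅ w ⁆ ⁅ x ⁆ (x∈⁅x⁆ x) , edge-connected w~x)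

            minimal : ∀ U → InW c (bar c ⁅ w ⁆) U → _⪯_ c ⁅ w ⁆ U
            minimal U (U∈C , Ū≡) = ⊆-reflexive (cong (treePath T) (trans pick≡w (sym (pick-singleton w≢x))))
              where
                pick∈Ū : pick c U ∈ ⁅ w ⁆ ∪ ⁅ x ⁆
                pick∈Ū = subst (pick c U ∈_) (trans Ū≡ (bar-neighbour w~x)) (p⊆p∪q _ (pick-in c U U∈C))

                pick≡w : pick c U ≡ w
                pick≡w with x∈⁅y⁆∪⁅z⁆⁻ pick∈Ū
                ... | inj₁ pick≡w = pick≡w
                ... | inj₂ pick≡x = contradiction pick≡x (pick≢root U∈C)

  two-connected-on-3⇒complete : (G : Graph 3) → TwoConnected G → ∀ u v → u ≢ v → Graph._~_ G u v
  two-connected-on-3⇒complete G (_ , _ , connected-without) u v u≢v with avoid-two {0} u v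
  ... | z , z≢u , z≢v with last-edge (connected-without z (x≢y⇒x∈∁⁅y⁆ (z≢u ∘ sym)) (x≢y⇒x∈∁⁅y⁆ (z≢v ∘ sym))) u≢v
  ... | w , w∈ , w~v =
    subst (λ a → Graph._~_ G a v) (fin3-remaining u v z w u≢v z≢u z≢v (adjacent⇒≢ {G = G} w~v) (x∈∁⁅y⁆⇒x≢y w∈)) w~v

  order-3⇒K3 : ∀ {k} (G : Graph (3 + k)) → TwoConnected G → k ≡ 0 → IsK3 G
  order-3⇒K3 G tc refl = refl , two-connected-on-3⇒complete G tc

  module _ {k : ℕ} {G : Graph (3 + k)} (tc : TwoConnected G) where
    open Graph G using (_~_)

    two-neighbours : ∀ x → ∃₂ λ w₁ w₂ → w₁ ≢ w₂ × w₁ ~ x × w₂ ~ x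
    two-neighbours x with avoid-two x x
    ... | y₁ , y₁≢x , _ with last-edge (proj₁ (proj₂ tc) {y₁} {x} ∈⊤ ∈⊤) y₁≢x
    ... | w₁ , _ , w₁~x with avoid-two x w₁
    ... | y₂ , y₂≢x , y₂≢w₁
      with last-edge (proj₂ (proj₂ tc) w₁ (x≢y⇒x∈∁⁅y⁆ y₂≢w₁) (x≢y⇒x∈∁⁅y⁆ (adjacent⇒≢ {G = G} w₁~x ∘ sym))) y₂≢x
    ... | w₂ , w₂∈ , w₂~x = w₁ , w₂ , (λ w₁≡w₂ → x∈∁⁅y⁆⇒x≢y w₂∈ (sym w₁≡w₂)) , w₁~x , w₂~x

    module _ {x : Fin (3 + k)} {T : SDTree G x} (c : Choice T) {Ms : List (Subset (3 + k))} (E : EnumM c Ms) where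

      ∈Ms⇒∈C : ∀ {U} → U ∈ₗ Ms → InCminus G x U
      ∈Ms⇒∈C U∈Ms with Equivalence.to (proj₂ E _) U∈Ms
      ... | _ , _ , (U∈C , _) , _ = U∈C

      neighbour-∈Ms : ∀ {w} → w ~ x → ⁅ w ⁆ ∈ₗ Ms
      neighbour-∈Ms w~x = Equivalence.from (proj₂ E _) (neighbour-∈M T c w~x)

      Ms-inhabited : ∃ λ U → U ∈ₗ Ms
      Ms-inhabited with two-neighbours x
      ... | w₁ , _ , _ , w₁~x , _ = ⁅ w₁ ⁆ , neighbour-∈Ms w₁~x

      lenP-sum-with-slack : 2 * sum (map (lenP c) Ms) + 2 * k ≤ (2 + k) * length Ms + 1
      lenP-sum-with-slack with two-neighbours x
      ... | w₁ , w₂ , w₁≢w₂ , w₁~x , w₂~x = doubled-sum-bound k (lenP c) Ms (proj₁ E)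
        (λ _ → lenP-bound T tc c _)
        (λ U∈Ms U′∈Ms → lenP-extremal-unique T tc c (∈Ms⇒∈C U∈Ms) (∈Ms⇒∈C U′∈Ms))
        (λ ⁅w₁⁆≡⁅w₂⁆ → w₁≢w₂ (x∈⁅y⁆⇒x≡y w₂ (subst (w₁ ∈_) ⁅w₁⁆≡⁅w₂⁆ (x∈⁅x⁆ w₁))))
        (neighbour-∈Ms w₁~x) (neighbour-∈Ms w₂~x) (lenP-neighbour T c w₁~x) (lenP-neighbour T c w₂~x)

      lenP-sum-bound : 2 * sum (map (lenP c) Ms) ≤ (2 + k) * length Ms
      lenP-sum-bound = proj₁ (halving k (sum (map (lenP c) Ms)) (length Ms) lenP-sum-with-slack)

      lenP-sum-≡⇒k≡0 : 2 * sum (map (lenP c) Ms) ≡ (2 + k) * length Ms → k ≡ 0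
      lenP-sum-≡⇒k≡0 = proj₂ (halving k (sum (map (lenP c) Ms)) (length Ms) lenP-sum-with-slack)

      K3⇒lenP-sum-≡ : IsK3 G → 2 * sum (map (lenP c) Ms) ≡ (2 + k) * length Ms
      K3⇒lenP-sum-≡ (3+k≡3 , complete) = begin
        2 * sum (map (lenP c) Ms)  ≡⟨ cong (2 *_) (sum-map-≡-length (lenP c) Ms all-one) ⟩
        2 * length Ms              ≡⟨ cong (λ j → (2 + j) * length Ms) k≡0 ⟨
        (2 + k) * length Ms        ∎
        where
          open ≡-Reasoning
          k≡0 : k ≡ 0
          k≡0 = suc-injective (suc-injective (suc-injective 3+k≡3))
          all-one : ∀ {U} → U ∈ₗ Ms → lenP c U ≡ 1
          all-one U∈Ms = depth-neighbour T (complete _ x (pick≢root T c (∈Ms⇒∈C U∈Ms)))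

open import Data.Integer using (+_)
open import Data.Rational.Unnormalised using (_/_; _≤_; _≃_)

theorem5p2 : {n : ℕ} (G : Graph n) → TwoConnected G → (x : Fin n) →
    (T : SDTree G x) (c : Choice T) (Ms : List (Subset n)) → EnumM c Ms →
    (av c Ms ≤ (+ (n ∸ 1)) / 2) × ((av c Ms ≃ (+ (n ∸ 1)) / 2) ⇔ IsK3 G)
theorem5p2 {0}             G (() , _)           x T c Ms E
theorem5p2 {1}             G (s≤s () , _)       x T c Ms E
theorem5p2 {2}             G (s≤s (s≤s ()) , _) x T c Ms E
theorem5p2 {suc (suc (suc k))} G tc x T c Ms E =
    avg-map-≤-half (lenP c) (suc (suc k)) Ms (lenP-sum-bound tc c E)
  , mk⇔ (λ av≃ → order-3⇒K3 G tc (lenP-sum-≡⇒k≡0 tc c E (Equivalence.to av≃⇔ av≃)))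
        (λ K3 → Equivalence.from av≃⇔ (K3⇒lenP-sum-≡ tc c E K3))
  where
    av≃⇔ = avg-map-≃-half (lenP c) (suc (suc k)) Ms (proj₂ (Ms-inhabited tc c E))
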